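{- Let $S$ be a cosimplicial complex with $N=|S|$, let $F:S\to\mathbb{Z}$ be a stack on $S$, and let $S[1],\dots,S[N]$ be an enumeration of $S$ such that for all $1\le i<j\le N$: $F(S[i])\ge F(S[j])$, and $\dim(S[i])\ge\dim(S[j])$ whenever $F(S[i])=F(S[j])$. Then the output of the procedure $\mathbf{Min}(S,F)$ described below (for any choice of the elements extracted from $U$) is a minimal simplex-wise $F$-sequence on $S$. Procedure $\mathbf{Min}(S,F)$: set $i:=1$, $T:=\emptyset$, $U:=\emptyset$, $W:=\langle\,\rangle$. For each $\sigma\in S$ set $\rho(\sigma):=|\delta(\sigma,S)|$ and add $\sigma$ to $U$ if $\rho(\sigma)=1$. Then, while $i\le N$, repeat: (a) while $U\ne\emptyset$: remove an arbitrary $\sigma$ from $U$; if $\rho(\sigma)=1$, let $\tau$ be the element of $\delta(\sigma,S)$ with $\tau\notin T$; if $F(\tau)=F(\sigma)$, prepend the pair $(\sigma,\tau)$ to the front of $W$, set $T:=T\cup\{\sigma,\tau\}$, and for each $\mu\in\partial(\sigma,S)\cup\partial(\tau,S)$ decrease $\rho(\mu)$ by $1$ and add $\mu$ to $U$ if $\rho(\mu)=1$; (b) while $i\le N$ and $S[i]\in T$, set $i:=i+1$; (c) if $i\le N$: let $\tau:=S[i]$, set $T:=T\cup\{\tau\}$, prepend $\tau$ to the front of $W$, and for each $\sigma\in\partial(\tau,S)$ decrease $\rho(\sigma)$ by $1$ and add $\sigma$ to $U$ if $\rho(\sigma)=1$. Return $W$.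
   Context: A simplicial complex is a finite family of non-empty finite sets (simplexes) closed under taking non-empty subsets; $\dim(\sigma)=|\sigma|-1$. For a complex $K$ and $\sigma\in K$: $\partial(\sigma,K)=\{\mu\in K:\mu\subseteq\sigma,\dim\mu=\dim\sigma-1\}$, $\delta(\sigma,K)=\{\mu\in K:\sigma\subseteq\mu,\dim\mu=\dim\sigma+1\}$. A pair $(\sigma,\tau)$ with $\sigma\subsetneq\tau$ in $K$ is a free pair for $K$ if $\tau$ is the only face of $K$ other than $\sigma$ containing $\sigma$; then $K$ is an elementary expansion of $K\setminus\{\sigma,\tau\}$ and $K\setminus\{\sigma,\tau\}$ is an elementary collapse of $K$. If $\nu$ is a maximal face of $K$, then $K$ is an elementary filling of $K\setminus\{\nu\}$. A finite set $S$ of simplexes is a cosimplicial complex if $\nu\in S$ whenever $\sigma\subseteq\nu\subseteq\tau$ with $\sigma,\tau\in S$. $\overline{S}$ is the set of simplexes contained in some element of $S$, $\underline{S}=\overline{S}\setminus S$. For $\nu\in S$: $\partial(\nu,S)=\partial(\nu,\overline{S})\cap S$, $\delta(\nu,S)=\delta(\nu,\overline{S})$. A stack on $S$ is $F:S\to\mathbb{Z}$ with $F(\sigma)\le F(\tau)$ whenever $\sigma\subseteq\tau$ in $S$. A Morse sequence from $L$ to $K$ is a sequence $\langle L=K_0,\dots,K_k=K\rangle$ of simplicial complexes, each $K_i$ an elementary expansion or elementary filling of $K_{i-1}$; its simplex-wise form is $\langle\kappa_1,\dots,\kappa_k\rangle$ with $\kappa_i=\nu$ (critical) if $K_i=K_{i-1}\cup\{\nu\}$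 is a filling and $\kappa_i=(\sigma,\tau)$ (regular) if $K_i=K_{i-1}\cup\{\sigma,\tau\}$ is an expansion with free pair $(\sigma,\tau)$. A (simplex-wise) $F$-sequence on $S$ is (the simplex-wise form of) a Morse sequence from $\underline{S}$ to $\overline{S}$ in which every regular pair $(\sigma,\tau)$ satisfies $F(\sigma)=F(\tau)$. It is minimal (for $F$) if for every $i\in[1,k]$ such that $K_i$ is an elementary filling of $K_{i-1}$, there is no free pair $(\sigma,\tau)$ for $K_i$ with $\sigma,\tau\in S$ and $F(\sigma)=F(\tau)$. -}

module Defs where

open import Data.Nat using (ℕ; zero; suc; _∸_; _≤_; _<_)
open import Data.Integer using (ℤ; +_; _-_) renaming (_≤_ to _≤ℤ_)
open import Data.Bool using (Bool; true; false)
open import Data.Maybe using (Maybe; just; nothing)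
open import Data.List using (List; []; _∷_; length)
open import Data.List.Membership.Propositional using (_∈_; _∉_)
open import Data.List.Relation.Unary.Unique.Propositional using (Unique)
open import Data.Fin.Subset using (Subset; Nonempty; ∣_∣) renaming (_⊆_ to _⊆ˢ_)
open import Data.Product using (Σ; ∃; ∃-syntax; _×_; _,_)
open import Data.Sum using (_⊎_)
open import Data.Unit using (⊤)
open import Relation.Nullary using (¬_)
open import Relation.Binary.PropositionalEquality using (_≡_; _≢_)
open import Relation.Binary.Construct.Closure.ReflexiveTransitive using (Star)

-- Simplexes are (non-empty) finite subsets of a vertex set Fin n.
-- A family of simplexes over Fin n is a predicate on Subset n.

Family : ℕ → Set₁
Family n = Subset n → Set

module _ {n : ℕ} where

  dim : Subset n → ℕ
  dim σ = ∣ σ ∣ ∸ 1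

  _≐_ : Family n → Family n → Set
  K ≐ M = ∀ μ → (K μ → M μ) × (M μ → K μ)

  _∪₁_ : Family n → Subset n → Family n
  (K ∪₁ ν) μ = K μ ⊎ μ ≡ ν

  _∪₂_,_ : Family n → Subset n → Subset n → Family n
  (K ∪₂ σ , τ) μ = K μ ⊎ (μ ≡ σ ⊎ μ ≡ τ)

  -- simplicial complex: non-empty simplexes, closed under non-empty subsets
  -- (finiteness is automatic over the finite vertex set Fin n)
  IsComplex : Family n → Set
  IsComplex K = (∀ σ → K σ → Nonempty σ)
              × (∀ σ τ → K τ → σ ⊆ˢ τ → Nonempty σ → K σ)

  ∂ : Family n → Subset n → Family n
  ∂ K σ μ = K μ × μ ⊆ˢ σ × suc (dim μ) ≡ dim σ

  δ : Family n → Subset n → Family n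
  δ K σ μ = K μ × σ ⊆ˢ μ × dim μ ≡ suc (dim σ)

  FreePair : Family n → Subset n → Subset n → Set
  FreePair K σ τ = K σ × K τ × σ ⊆ˢ τ × σ ≢ τ
                 × (∀ μ → K μ → σ ⊆ˢ μ → μ ≡ σ ⊎ μ ≡ τ)

  Maximal : Family n → Subset n → Set
  Maximal K ν = K ν × (∀ μ → K μ → ν ⊆ˢ μ → μ ≡ ν)

  -- K ∪ {ν} is an elementary filling of K (= (K ∪ {ν}) \ {ν})
  Filling : Family n → Subset n → Set
  Filling K ν = ¬ K ν × IsComplex (K ∪₁ ν) × Maximal (K ∪₁ ν) ν

  -- K ∪ {σ,τ} is an elementary expansion of K (= (K ∪ {σ,τ}) \ {σ,τ})
  -- with free pair (σ, τ)
  Expansion : Family n → Subset n → Subset n → Set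
  Expansion K σ τ = ¬ K σ × ¬ K τ × IsComplex (K ∪₂ σ , τ)
                  × FreePair (K ∪₂ σ , τ) σ τ

data Item (n : ℕ) : Set where
  crit : Subset n → Item n
  reg  : Subset n → Subset n → Item n

module _ {n : ℕ} where

  -- ⟨κ₁,…,κ_k⟩ is (the simplex-wise form of) a Morse sequence from K to M
  -- (K is required to be a complex; each step is a complex by Filling/Expansion)
  MorseSteps : Family n → List (Item n) → Family n → Set
  MorseSteps K [] M = K ≐ M
  MorseSteps K (crit ν ∷ w) M = Filling K ν × MorseSteps (K ∪₁ ν) w M
  MorseSteps K (reg σ τ ∷ w) M = Expansion K σ τ × MorseSteps (K ∪₂ σ , τ) w M

  MorseSeq : Family n → List (Item n) → Family n → Set
  MorseSeq K w M = IsComplex K × MorseSteps K w M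

module _ {n : ℕ} (S : List (Subset n)) where

  InS : Family n
  InS σ = σ ∈ S

  IsCosimplicial : Set
  IsCosimplicial = Unique S
                 × (∀ σ → σ ∈ S → Nonempty σ)
                 × (∀ σ ν τ → σ ∈ S → τ ∈ S → σ ⊆ˢ ν → ν ⊆ˢ τ → ν ∈ S)

  Closure : Family n
  Closure μ = Nonempty μ × ∃[ τ ] (τ ∈ S × μ ⊆ˢ τ)

  Under : Family n
  Under μ = Closure μ × μ ∉ S

  ∂S : Subset n → Family n
  ∂S ν μ = ∂ Closure ν μ × μ ∈ S

  δS : Subset n → Family n
  δS ν = δ Closure ν

  IsStack : (Subset n → ℤ) → Set
  IsStack F = ∀ σ τ → σ ∈ S → τ ∈ S → σ ⊆ˢ τ → F σ ≤ℤ F τ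

-- 1-based indexing: at xs i = just (xs[i]) iff 1 ≤ i ≤ length xs
at : ∀ {A : Set} → List A → ℕ → Maybe A
at []       _             = nothing
at (x ∷ xs) zero          = nothing
at (x ∷ xs) (suc zero)    = just x
at (x ∷ xs) (suc (suc i)) = at xs (suc i)

module _ {n : ℕ} (S : List (Subset n)) (F : Subset n → ℤ) where

  IsSortedEnum : Set
  IsSortedEnum = ∀ i j σ τ → i < j → at S i ≡ just σ → at S j ≡ just τ
               → F τ ≤ℤ F σ × (F σ ≡ F τ → dim τ ≤ dim σ)

  RegularPairsFlat : List (Item n) → Set
  RegularPairsFlat [] = ⊤
  RegularPairsFlat (crit _ ∷ w) = RegularPairsFlat w
  RegularPairsFlat (reg σ τ ∷ w) = F σ ≡ F τ × RegularPairsFlat w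

  IsFSequence : List (Item n) → Set
  IsFSequence w = MorseSeq (Under S) w (Closure S) × RegularPairsFlat w

  MinFrom : Family n → List (Item n) → Set
  MinFrom K [] = ⊤
  MinFrom K (crit ν ∷ w) =
    (∀ σ τ → σ ∈ S → τ ∈ S → F σ ≡ F τ → ¬ FreePair (K ∪₁ ν) σ τ)
    × MinFrom (K ∪₁ ν) w
  MinFrom K (reg σ τ ∷ w) = MinFrom (K ∪₂ σ , τ) w

  IsMinimalFSequence : List (Item n) → Set
  IsMinimalFSequence w = IsFSequence w × MinFrom (Under S) w

  -- The procedure Min(S,F), as a nondeterministic small-step machine.

  N : ℕ
  N = length S

  Card : Family n → ℕ → Set
  Card P k = Σ (List (Subset n)) λ L → Unique L
           × (∀ μ → (μ ∈ L → P μ) × (P μ → μ ∈ L)) × length L ≡ k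

  data Phase : Set where
    outer loopA loopB stepC done : Phase

  record State : Set where
    constructor ⟨_,_,_,_,_,_⟩
    field
      pc : Phase
      i  : ℕ
      T  : Subset n → Bool
      U  : Subset n → Bool
      ρ  : Subset n → ℤ
      W  : List (Item n)

  -- ρ' and U' after "for each μ ∈ D: decrease ρ(μ) by 1 and add μ to U
  -- if ρ(μ) = 1", starting from ρ and U
  Decr : Family n → (Subset n → ℤ) → (Subset n → Bool)
       → (Subset n → ℤ) → (Subset n → Bool) → Set
  Decr D ρ U ρ' U' = ∀ μ → (D μ → ρ' μ ≡ ρ μ - + 1)
                         × (¬ D μ → ρ' μ ≡ ρ μ)
                         × (U' μ ≡ true → U μ ≡ true ⊎ (D μ × ρ' μ ≡ + 1))
                         × (U μ ≡ true ⊎ (D μ × ρ' μ ≡ + 1) → U' μ ≡ true)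

  Remove : (Subset n → Bool) → Subset n → (Subset n → Bool) → Set
  Remove U σ U₁ = ∀ μ → (U₁ μ ≡ true → U μ ≡ true × μ ≢ σ)
                      × (U μ ≡ true × μ ≢ σ → U₁ μ ≡ true)

  AddT : (Subset n → Bool) → Family n → (Subset n → Bool) → Set
  AddT T A T' = ∀ μ → (T' μ ≡ true → T μ ≡ true ⊎ A μ)
                    × (T μ ≡ true ⊎ A μ → T' μ ≡ true)

  _∪F_ : Family n → Family n → Family n
  (A ∪F B) μ = A μ ⊎ B μ

  Initial : State → Set
  Initial ⟨ pc , i , T , U , ρ , W ⟩ =
      pc ≡ outer × i ≡ 1 × (∀ μ → T μ ≡ false) × W ≡ []
    × (∀ σ → σ ∈ S → ∃[ k ] (Card (δS S σ) k × ρ σ ≡ + k))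
    × (∀ σ → (U σ ≡ true → σ ∈ S × ρ σ ≡ + 1) × (σ ∈ S × ρ σ ≡ + 1 → U σ ≡ true))

  data Step : State → State → Set where
    outer-go   : ∀ {i T U ρ W} → i ≤ N →
                 Step ⟨ outer , i , T , U , ρ , W ⟩ ⟨ loopA , i , T , U , ρ , W ⟩
    outer-stop : ∀ {i T U ρ W} → N < i →
                 Step ⟨ outer , i , T , U , ρ , W ⟩ ⟨ done , i , T , U , ρ , W ⟩
    a-exit     : ∀ {i T U ρ W} → (∀ μ → U μ ≡ false) →
                 Step ⟨ loopA , i , T , U , ρ , W ⟩ ⟨ loopB , i , T , U , ρ , W ⟩
    a-skip     : ∀ {i T U U₁ ρ W} σ → U σ ≡ true → Remove U σ U₁ →
                 ρ σ ≢ + 1 →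
                 Step ⟨ loopA , i , T , U , ρ , W ⟩ ⟨ loopA , i , T , U₁ , ρ , W ⟩
    a-noeq     : ∀ {i T U U₁ ρ W} σ τ → U σ ≡ true → Remove U σ U₁ →
                 ρ σ ≡ + 1 → δS S σ τ → T τ ≡ false → F τ ≢ F σ →
                 Step ⟨ loopA , i , T , U , ρ , W ⟩ ⟨ loopA , i , T , U₁ , ρ , W ⟩
    a-pair     : ∀ {i T T' U U₁ U' ρ ρ' W} σ τ → U σ ≡ true → Remove U σ U₁ →
                 ρ σ ≡ + 1 → δS S σ τ → T τ ≡ false → F τ ≡ F σ →
                 AddT T (λ μ → μ ≡ σ ⊎ μ ≡ τ) T' →
                 Decr (∂S S σ ∪F ∂S S τ) ρ U₁ ρ' U' →
                 Step ⟨ loopA , i , T , U , ρ , W ⟩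
                      ⟨ loopA , i , T' , U' , ρ' , reg σ τ ∷ W ⟩
    b-inc      : ∀ {i T U ρ W} σ → at S i ≡ just σ → T σ ≡ true →
                 Step ⟨ loopB , i , T , U , ρ , W ⟩ ⟨ loopB , suc i , T , U , ρ , W ⟩
    b-exit     : ∀ {i T U ρ W} →
                 (N < i ⊎ ∃[ σ ] (at S i ≡ just σ × T σ ≡ false)) →
                 Step ⟨ loopB , i , T , U , ρ , W ⟩ ⟨ stepC , i , T , U , ρ , W ⟩
    c-go       : ∀ {i T T' U U' ρ ρ' W} τ → at S i ≡ just τ →
                 AddT T (λ μ → μ ≡ τ) T' →
                 Decr (∂S S τ) ρ U ρ' U' →
                 Step ⟨ stepC , i , T , U , ρ , W ⟩
                      ⟨ outer , i , T' , U' , ρ' , crit τ ∷ W ⟩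
    c-skip     : ∀ {i T U ρ W} → N < i →
                 Step ⟨ stepC , i , T , U , ρ , W ⟩ ⟨ outer , i , T , U , ρ , W ⟩

  MinOutput : List (Item n) → Set
  MinOutput w = Σ State λ s₀ → Σ State λ s₁ →
    Initial s₀ × Star Step s₀ s₁ × State.pc s₁ ≡ done × State.W s₁ ≡ w

{-# OPTIONS --safe #-}
module Submission where

-- Min(S,F) runs a Morse sequence backwards. With T the simplexes output so far, W is a
-- Morse sequence from K = S̄ ∖ T to S̄, and ρ(σ) counts the cofacets of σ still in K.
-- In a complex, (σ, τ) is a free pair exactly when τ is the only cofacet of σ, so step (a)
-- removes free pairs of K; it also maintains that every σ ∈ S ∩ K with ρ(σ) = 1 whose
-- remaining cofacet has the same F-value is queued in U. Hence, once U is empty, K has no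
-- F-flat free pair inside S, which is minimality at the critical step (c). That step removes
-- S[i], the first simplex of the enumeration still in K. It is maximal in K: a proper coface
-- μ ∈ S of S[i] has F(μ) ≥ F(S[i]) since F is a stack, so if μ came later in the enumeration
-- it would have the same value and no larger dimension. At the end T = S, so K = S̲.

open import Defs
open import Data.Bool using (Bool; true; false)
import Data.Bool as Bool
open import Data.Bool.Properties using (¬-not; not-¬)
open import Data.Fin using (Fin; zero; suc)
open import Data.Fin.Subset
  using (Subset; Nonempty; ∣_∣; ⁅_⁆; _∪_; inside; outside)
  renaming (_⊆_ to _⊆ˢ_; _⊂_ to _⊂ˢ_; _∈_ to _∈ˢ_; _∉_ to _∉ˢ_)
open import Data.Fin.Subset.Properties
  using ( _∈?_; _⊂?_; ⊆-refl; ⊆-antisym; ⊆-trans; p⊂q⇒∣p∣<∣q∣; x∈p⇒∣p-x∣<∣p∣; x∈⁅x⁆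
        ; x∈⁅y⁆⇒x≡y; x∈p∪q⁺; x∈p∪q⁻; p⊆p∪q; ∪-identityʳ)
open import Data.Vec using (_∷_)
import Data.Vec as Vec
open import Data.Vec.Properties using (≡-dec)
open import Data.Integer using (ℤ; +_; _-_) renaming (_≤_ to _≤ℤ_)
import Data.Integer.Properties as ℤ
open import Data.List using (List; []; _∷_; length; filter)
open import Data.List.Membership.Propositional using (_∈_; find; lose)
open import Data.List.Membership.Propositional.Properties using (∈-filter⁺; ∈-filter⁻)
open import Data.List.Membership.Propositional.Properties.WithK using (unique∧set⇒bag)
open import Data.List.Relation.Binary.BagAndSetEquality using (∼bag⇒↭)
open import Data.List.Relation.Binary.Permutation.Propositional.Properties using (↭-length)
open import Data.List.Relation.Unary.Any using (here; there; any?)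
import Data.List.Relation.Unary.All as All
open import Data.List.Relation.Unary.AllPairs using ([]; _∷_)
open import Data.List.Relation.Unary.Unique.Propositional using (Unique)
import Data.List.Relation.Unary.Unique.Propositional.Properties as Unique
open import Data.Maybe using (just; nothing)
open import Data.Maybe.Properties using (just-injective)
open import Data.Unit using (⊤; tt)
open import Data.Nat using (ℕ; zero; suc; _∸_; _≤_; _<_; s≤s; _≤?_; z≤n; s<s⁻¹)
open import Data.Nat.Properties
  using (1+n≢n; ≰⇒>; <⇒≱; ≤⇒≯; <-cmp; m<1+n⇒m<n∨m≡n; ≤-<-trans; module ≤-Reasoning)
open import Data.Product using (∃-syntax; _×_; _,_; proj₁; proj₂)
open import Data.Sum using (_⊎_; inj₁; inj₂; [_,_])
import Data.Sum as Sum
import Data.Product as Product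
open import Function using (id; _∘′_; mk⇔)
open import Relation.Binary.Definitions using (DecidableEquality; tri<; tri≈; tri>)
open import Relation.Binary.PropositionalEquality
  using (_≡_; _≢_; refl; sym; trans; cong; subst; subst₂; ≢-sym)
open import Relation.Binary.Construct.Closure.ReflexiveTransitive using (Star; ε; _◅_)
open import Relation.Nullary using (¬_; yes; no; contradiction)
open import Relation.Unary using (Decidable)
open import Relation.Nullary.Decidable using (decidable-stable; ¬?; _⊎-dec_)

-- Finite sets and dimension

∣p∪⁅x⁆∣≡1+∣p∣ : ∀ {n} {p : Subset n} {x : Fin n} → x ∉ˢ p → ∣ p ∪ ⁅ x ⁆ ∣ ≡ suc ∣ p ∣
∣p∪⁅x⁆∣≡1+∣p∣ {p = inside ∷ p}  {zero}  x∉p = contradiction Vec.here x∉p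
∣p∪⁅x⁆∣≡1+∣p∣ {p = outside ∷ p} {zero}  x∉p = cong (suc ∘′ ∣_∣) (∪-identityʳ p)
∣p∪⁅x⁆∣≡1+∣p∣ {p = inside ∷ p}  {suc x} x∉p = cong suc (∣p∪⁅x⁆∣≡1+∣p∣ (x∉p ∘′ Vec.there))
∣p∪⁅x⁆∣≡1+∣p∣ {p = outside ∷ p} {suc x} x∉p = ∣p∪⁅x⁆∣≡1+∣p∣ (x∉p ∘′ Vec.there)

module _ {n : ℕ} where

  _≟ˢ_ : DecidableEquality (Subset n)
  _≟ˢ_ = ≡-dec Bool._≟_

  ⊆∧≢⇒⊂ : {p q : Subset n} → p ⊆ˢ q → p ≢ q → p ⊂ˢ q
  ⊆∧≢⇒⊂ {p} {q} p⊆q p≢q with p ⊂? q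
  ... | yes p⊂q = p⊂q
  ... | no p⊄q = contradiction (⊆-antisym p⊆q q⊆p) p≢q
    where
    q⊆p : q ⊆ˢ p
    q⊆p {x} x∈q = decidable-stable (x ∈? p) (λ x∉p → p⊄q (p⊆q , x , x∈q , x∉p))

  ⊆∧∣q∣≤∣p∣⇒≡ : {p q : Subset n} → p ⊆ˢ q → ∣ q ∣ ≤ ∣ p ∣ → p ≡ q
  ⊆∧∣q∣≤∣p∣⇒≡ {p} {q} p⊆q ∣q∣≤∣p∣ = decidable-stable (p ≟ˢ q)
    (λ p≢q → <⇒≱ (p⊂q⇒∣p∣<∣q∣ (⊆∧≢⇒⊂ p⊆q p≢q)) ∣q∣≤∣p∣)

  x∈p∪⁅x⁆ : {p : Subset n} (x : Fin n) → x ∈ˢ p ∪ ⁅ x ⁆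
  x∈p∪⁅x⁆ x = x∈p∪q⁺ (inj₂ (x∈⁅x⁆ x))

  p∪⁅x⁆⊆q : {p q : Subset n} {x : Fin n} → p ⊆ˢ q → x ∈ˢ q → p ∪ ⁅ x ⁆ ⊆ˢ q
  p∪⁅x⁆⊆q {p} {q} {x} p⊆q x∈q y∈p∪⁅x⁆ =
    [ p⊆q , (λ y∈⁅x⁆ → subst (_∈ˢ q) (sym (x∈⁅y⁆⇒x≡y x y∈⁅x⁆)) x∈q) ] (x∈p∪q⁻ p ⁅ x ⁆ y∈p∪⁅x⁆)

  ∣σ∣≡1+dimσ : {σ : Subset n} → Nonempty σ → ∣ σ ∣ ≡ suc (dim σ)
  ∣σ∣≡1+dimσ {σ} (x , x∈σ) with ∣ σ ∣ | x∈p⇒∣p-x∣<∣p∣ x∈σ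
  ... | suc _ | _ = refl

  dim-∪⁅⁆ : {σ : Subset n} {b : Fin n} → Nonempty σ → b ∉ˢ σ → dim (σ ∪ ⁅ b ⁆) ≡ suc (dim σ)
  dim-∪⁅⁆ σ≠∅ b∉σ = trans (cong (_∸ 1) (∣p∪⁅x⁆∣≡1+∣p∣ b∉σ)) (∣σ∣≡1+dimσ σ≠∅)

  ⊆∧≢⇒dim< : {p q : Subset n} → Nonempty p → p ⊆ˢ q → p ≢ q → dim p < dim q
  ⊆∧≢⇒dim< p≠∅@(x , x∈p) p⊆q p≢q = s<s⁻¹ (subst₂ _<_ (∣σ∣≡1+dimσ p≠∅) (∣σ∣≡1+dimσ (x , p⊆q x∈p))
                                                   (p⊂q⇒∣p∣<∣q∣ (⊆∧≢⇒⊂ p⊆q p≢q)))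

  dim≡1+dim⇒≢ : {σ τ : Subset n} → dim τ ≡ suc (dim σ) → τ ≢ σ
  dim≡1+dim⇒≢ dτ τ≡σ = 1+n≢n (trans (sym dτ) (cong dim τ≡σ))

  ⊆-between-cofacet : {σ μ τ : Subset n} → Nonempty σ → σ ⊆ˢ μ → μ ⊆ˢ τ →
                      dim τ ≡ suc (dim σ) → μ ≡ σ ⊎ μ ≡ τ
  ⊆-between-cofacet {σ} {μ} {τ} σ≠∅@(x , x∈σ) σ⊆μ μ⊆τ dτ with ∣ μ ∣ ≤? ∣ σ ∣
  ... | yes ∣μ∣≤∣σ∣ = inj₁ (sym (⊆∧∣q∣≤∣p∣⇒≡ σ⊆μ ∣μ∣≤∣σ∣))
  ... | no ∣μ∣≰∣σ∣ = inj₂ (⊆∧∣q∣≤∣p∣⇒≡ μ⊆τ ∣τ∣≤∣μ∣)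
    where
    open ≤-Reasoning
    ∣τ∣≤∣μ∣ : ∣ τ ∣ ≤ ∣ μ ∣
    ∣τ∣≤∣μ∣ = begin
      ∣ τ ∣              ≡⟨ ∣σ∣≡1+dimσ (x , μ⊆τ (σ⊆μ x∈σ)) ⟩
      suc (dim τ)        ≡⟨ cong suc dτ ⟩
      suc (suc (dim σ))  ≡⟨ cong suc (∣σ∣≡1+dimσ σ≠∅) ⟨
      suc ∣ σ ∣          ≤⟨ ≰⇒> ∣μ∣≰∣σ∣ ⟩
      ∣ μ ∣              ∎

-- Cofacets and free pairs

module _ {n : ℕ} where

  δ-mono : ∀ {K M : Family n} {σ μ} → (∀ {ν} → K ν → M ν) → δ K σ μ → δ M σ μ
  δ-mono K⊆M (Kμ , σ⊆μ , dμ) = K⊆M Kμ , σ⊆μ , dμ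

  SoleCofacet : Family n → Subset n → Subset n → Set
  SoleCofacet K σ τ = δ K σ τ × (∀ ν → δ K σ ν → ν ≡ τ)

module _ {n : ℕ} {K : Family n} (K-complex : IsComplex K) where

  private
    K-nonempty : ∀ {σ} → K σ → Nonempty σ
    K-nonempty = proj₁ K-complex _

  cofacet-inside : ∀ {σ μ b} → K σ → K μ → σ ⊆ˢ μ → b ∈ˢ μ → b ∉ˢ σ → δ K σ (σ ∪ ⁅ b ⁆)
  cofacet-inside {σ} {μ} {b} Kσ Kμ σ⊆μ b∈μ b∉σ =
      proj₂ K-complex _ μ Kμ (p∪⁅x⁆⊆q σ⊆μ b∈μ) (b , x∈p∪⁅x⁆ b)
    , p⊆p∪q ⁅ b ⁆
    , dim-∪⁅⁆ (K-nonempty Kσ) b∉σ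

  -- Every vertex b of μ ⊇ σ outside σ spans the cofacet σ ∪ {b}, which must be τ.
  sole-cofacet-contains : ∀ {σ τ μ} → K σ → SoleCofacet K σ τ → K μ → σ ⊆ˢ μ → μ ⊆ˢ τ
  sole-cofacet-contains {σ} Kσ ((_ , σ⊆τ , _) , sole) Kμ σ⊆μ {b} b∈μ with b ∈? σ
  ... | yes b∈σ = σ⊆τ b∈σ
  ... | no b∉σ = subst (b ∈ˢ_) (sole _ (cofacet-inside Kσ Kμ σ⊆μ b∈μ b∉σ)) (x∈p∪⁅x⁆ b)

  sole-cofacet⇒free : ∀ {σ τ} → K σ → SoleCofacet K σ τ → FreePair K σ τ
  sole-cofacet⇒free Kσ sc@((Kτ , σ⊆τ , dτ) , _) =
    Kσ , Kτ , σ⊆τ , ≢-sym (dim≡1+dim⇒≢ dτ) ,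
    λ μ Kμ σ⊆μ → ⊆-between-cofacet (K-nonempty Kσ) σ⊆μ (sole-cofacet-contains Kσ sc Kμ σ⊆μ) dτ

  free⇒sole-cofacet : ∀ {σ τ} → FreePair K σ τ → SoleCofacet K σ τ
  free⇒sole-cofacet {σ} {τ} fp@(Kσ , Kτ , σ⊆τ , σ≢τ , _) with ⊆∧≢⇒⊂ σ⊆τ σ≢τ
  ... | _ , b , b∈τ , b∉σ = subst (δ K σ) (cofacet≡τ _ cof) cof , cofacet≡τ
    where
    cof : δ K σ (σ ∪ ⁅ b ⁆)
    cof = cofacet-inside Kσ Kτ σ⊆τ b∈τ b∉σ
    cofacet≡τ : ∀ ν → δ K σ ν → ν ≡ τ
    cofacet≡τ ν (Kν , σ⊆ν , dν) with proj₂ (proj₂ (proj₂ (proj₂ fp))) ν Kν σ⊆ν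
    ... | inj₁ ν≡σ = contradiction ν≡σ (dim≡1+dim⇒≢ dν)
    ... | inj₂ ν≡τ = ν≡τ

module _ {n : ℕ} where

  ≐-sym : {K M : Family n} → K ≐ M → M ≐ K
  ≐-sym K≐M μ = proj₂ (K≐M μ) , proj₁ (K≐M μ)

  ≐-trans : {K M L : Family n} → K ≐ M → M ≐ L → K ≐ L
  ≐-trans K≐M M≐L μ = proj₁ (M≐L μ) ∘′ proj₁ (K≐M μ) , proj₂ (K≐M μ) ∘′ proj₂ (M≐L μ)

  ∪₁-cong : {K M : Family n} (ν : Subset n) → K ≐ M → (K ∪₁ ν) ≐ (M ∪₁ ν)
  ∪₁-cong ν K≐M μ = Sum.map₁ (proj₁ (K≐M μ)) , Sum.map₁ (proj₂ (K≐M μ))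

  ∪₂-cong : {K M : Family n} (σ τ : Subset n) → K ≐ M → (K ∪₂ σ , τ) ≐ (M ∪₂ σ , τ)
  ∪₂-cong σ τ K≐M μ = Sum.map₁ (proj₁ (K≐M μ)) , Sum.map₁ (proj₂ (K≐M μ))

  IsComplex-resp-≐ : {K M : Family n} → K ≐ M → IsComplex K → IsComplex M
  IsComplex-resp-≐ K≐M (nonempty , closed) =
      (λ σ Mσ → nonempty σ (proj₂ (K≐M σ) Mσ))
    , (λ σ τ Mτ σ⊆τ σ≠∅ → proj₁ (K≐M σ) (closed σ τ (proj₂ (K≐M τ) Mτ) σ⊆τ σ≠∅))

  FreePair-resp-≐ : {K M : Family n} {σ τ : Subset n} → K ≐ M → FreePair K σ τ → FreePair M σ τ
  FreePair-resp-≐ {σ = σ} {τ} K≐M (Kσ , Kτ , σ⊆τ , σ≢τ , only) =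
    proj₁ (K≐M σ) Kσ , proj₁ (K≐M τ) Kτ , σ⊆τ , σ≢τ ,
    λ μ Mμ → only μ (proj₂ (K≐M μ) Mμ)

  Maximal-resp-≐ : {K M : Family n} {ν : Subset n} → K ≐ M → Maximal K ν → Maximal M ν
  Maximal-resp-≐ {ν = ν} K≐M (Kν , maximal) =
    proj₁ (K≐M ν) Kν , λ μ Mμ → maximal μ (proj₂ (K≐M μ) Mμ)

  Filling-resp-≐ : {K M : Family n} {ν : Subset n} → K ≐ M → Filling K ν → Filling M ν
  Filling-resp-≐ {ν = ν} K≐M (ν∉K , complex , maximal) =
      ν∉K ∘′ proj₂ (K≐M ν)
    , IsComplex-resp-≐ (∪₁-cong ν K≐M) complex
    , Maximal-resp-≐ (∪₁-cong ν K≐M) maximal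

  Expansion-resp-≐ : {K M : Family n} {σ τ : Subset n} → K ≐ M → Expansion K σ τ → Expansion M σ τ
  Expansion-resp-≐ {σ = σ} {τ} K≐M (σ∉K , τ∉K , complex , free) =
      σ∉K ∘′ proj₂ (K≐M σ)
    , τ∉K ∘′ proj₂ (K≐M τ)
    , IsComplex-resp-≐ (∪₂-cong σ τ K≐M) complex
    , FreePair-resp-≐ (∪₂-cong σ τ K≐M) free

  MorseSteps-resp-≐ : {K M L : Family n} (w : List (Item n)) →
                      K ≐ M → MorseSteps K w L → MorseSteps M w L
  MorseSteps-resp-≐ []              K≐M K≐L         = ≐-trans (≐-sym K≐M) K≐L
  MorseSteps-resp-≐ (crit ν ∷ w)    K≐M (fill , ms) =
    Filling-resp-≐ K≐M fill , MorseSteps-resp-≐ w (∪₁-cong ν K≐M) ms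
  MorseSteps-resp-≐ (reg σ τ ∷ w)   K≐M (exp , ms)  =
    Expansion-resp-≐ K≐M exp , MorseSteps-resp-≐ w (∪₂-cong σ τ K≐M) ms

  MinFrom-resp-≐ : (S : List (Subset n)) (F : Subset n → ℤ) {K M : Family n} (w : List (Item n)) →
                   K ≐ M → MinFrom S F K w → MinFrom S F M w
  MinFrom-resp-≐ S F []            K≐M _              = tt
  MinFrom-resp-≐ S F (crit ν ∷ w)  K≐M (no-flat , mf) =
      (λ σ τ σ∈S τ∈S Fσ≡Fτ → no-flat σ τ σ∈S τ∈S Fσ≡Fτ ∘′ FreePair-resp-≐ (≐-sym (∪₁-cong ν K≐M)))
    , MinFrom-resp-≐ S F w (∪₁-cong ν K≐M) mf
  MinFrom-resp-≐ S F (reg σ τ ∷ w) K≐M mf = MinFrom-resp-≐ S F w (∪₂-cong σ τ K≐M) mf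

module _ {A : Set} where

  at-∈ : (xs : List A) (i : ℕ) {x : A} → at xs i ≡ just x → x ∈ xs
  at-∈ (y ∷ xs) (suc zero)    refl = here refl
  at-∈ (y ∷ xs) (suc (suc i)) eq   = there (at-∈ xs (suc i) eq)

  ∈⇒at : {xs : List A} {x : A} → x ∈ xs → ∃[ i ] (at xs (suc i) ≡ just x × suc i ≤ length xs)
  ∈⇒at (here refl) = zero , refl , s≤s z≤n
  ∈⇒at (there x∈xs) with ∈⇒at x∈xs
  ... | i , eq , 1+i≤∣xs∣ = suc i , eq , s≤s 1+i≤∣xs∣

  at-0 : (xs : List A) → at xs 0 ≡ nothing
  at-0 []       = refl
  at-0 (_ ∷ _) = refl

  at-beyond : (xs : List A) (i : ℕ) → length xs < i → at xs i ≡ nothing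
  at-beyond []            i             _             = refl
  at-beyond (x ∷ [])      (suc zero)    (s≤s ())
  at-beyond (x ∷ [])      (suc (suc i)) _             = refl
  at-beyond (x ∷ y ∷ xs)  (suc (suc i)) (s≤s ∣xs∣<i) = at-beyond (y ∷ xs) (suc i) ∣xs∣<i

-- The procedure Min

module MinProcedure {n : ℕ} (S : List (Subset n)) (F : Subset n → ℤ) where

  -- Card is declared in Defs under the parameters S and F, but depends on neither.
  Card-resp-≐ : {P Q : Family n} {k : ℕ} → P ≐ Q → Card S F P k → Card S F Q k
  Card-resp-≐ P≐Q (L , unique , L≐P , ∣L∣≡k) = L , unique , ≐-trans L≐P P≐Q , ∣L∣≡k

  Card-unique : {P : Family n} {k m : ℕ} → Card S F P k → Card S F P m → k ≡ m
  Card-unique (L , L-unique , L≐P , refl) (M , M-unique , M≐P , refl) =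
    ↭-length (∼bag⇒↭ (unique∧set⇒bag L-unique M-unique (λ {μ} → mk⇔ (L⇒M μ) (M⇒L μ))))
    where
    L⇒M : ∀ μ → μ ∈ L → μ ∈ M
    L⇒M μ = proj₂ (M≐P μ) ∘′ proj₁ (L≐P μ)
    M⇒L : ∀ μ → μ ∈ M → μ ∈ L
    M⇒L μ = proj₂ (L≐P μ) ∘′ proj₁ (M≐P μ)

  Card-remove : {P : Family n} {k : ℕ} {x : Subset n} → Card S F P k → P x →
                ∃[ k′ ] (k ≡ suc k′ × Card S F (λ μ → P μ × μ ≢ x) k′)
  Card-remove {P} {x = x} card@(L , L-unique , L≐P , _) Px =
    length L′ , Card-unique card x∷L′-card , L′ , L′-unique , L′≐P-x , refl
    where
    L′ : List (Subset n)
    L′ = filter (λ μ → ¬? (μ ≟ˢ x)) L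
    L′-unique : Unique L′
    L′-unique = Unique.filter⁺ _ L-unique
    L′≐P-x : (_∈ L′) ≐ (λ μ → P μ × μ ≢ x)
    L′≐P-x μ = (λ μ∈L′ → Product.map₁ (proj₁ (L≐P μ)) (∈-filter⁻ _ μ∈L′))
             , (λ (Pμ , μ≢x) → ∈-filter⁺ _ (proj₂ (L≐P μ) Pμ) μ≢x)
    x∷L′≐P : (_∈ x ∷ L′) ≐ P
    x∷L′≐P μ = x∷L′⇒P , P⇒x∷L′
      where
      x∷L′⇒P : μ ∈ x ∷ L′ → P μ
      x∷L′⇒P (here refl)  = Px
      x∷L′⇒P (there μ∈L′) = proj₁ (proj₁ (L′≐P-x μ) μ∈L′)
      P⇒x∷L′ : P μ → μ ∈ x ∷ L′
      P⇒x∷L′ Pμ with μ ≟ˢ x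
      ... | yes refl = here refl
      ... | no μ≢x   = there (proj₂ (L′≐P-x μ) (Pμ , μ≢x))
    x∷L′-card : Card S F P (suc (length L′))
    x∷L′-card = x ∷ L′
              , All.tabulate (λ {μ} μ∈L′ → ≢-sym (proj₂ (proj₁ (L′≐P-x μ) μ∈L′))) ∷ L′-unique
              , x∷L′≐P , refl

  Card-1⇒≡ : {P : Family n} {x y : Subset n} → Card S F P 1 → P x → P y → x ≡ y
  Card-1⇒≡ (z ∷ [] , _ , L≐P , _) Px Py with proj₂ (L≐P _) Px | proj₂ (L≐P _) Py
  ... | here refl | here refl = refl

  sole⇒Card-1 : {P : Family n} {x : Subset n} → P x → (∀ μ → P μ → μ ≡ x) → Card S F P 1
  sole⇒Card-1 {P} {x} Px sole =
    x ∷ [] , All.[] ∷ [] , (λ μ → [x]⇒P μ , λ Pμ → here (sole μ Pμ)) , refl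
    where
    [x]⇒P : ∀ μ → μ ∈ x ∷ [] → P μ
    [x]⇒P μ (here refl) = Px

  Closure-isComplex : IsComplex (Closure S)
  Closure-isComplex =
    (λ _ → proj₁) , λ σ τ (_ , ν , ν∈S , τ⊆ν) σ⊆τ σ≠∅ → σ≠∅ , ν , ν∈S , ⊆-trans σ⊆τ τ⊆ν

  Remaining : (Subset n → Bool) → Family n
  Remaining T μ = Closure S μ × T μ ≡ false

  QueueEmpty : (Subset n → Bool) → Set
  QueueEmpty U = ∀ μ → U μ ≡ false

  module _ {T T′ : Subset n → Bool} {A : Family n} (T′≡T∪A : AddT S F T A T′) where

    AddT-⊇ : ∀ {μ} → T μ ≡ true → T′ μ ≡ true
    AddT-⊇ Tμ = proj₂ (T′≡T∪A _) (inj₁ Tμ)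

    AddT-∋ : ∀ {μ} → A μ → T′ μ ≡ true
    AddT-∋ Aμ = proj₂ (T′≡T∪A _) (inj₂ Aμ)

    AddT-∉ : ∀ {μ} → T′ μ ≡ false → T μ ≡ false × ¬ A μ
    AddT-∉ T′μ = ¬-not (not-¬ T′μ ∘′ AddT-⊇) , not-¬ T′μ ∘′ AddT-∋

    Remaining-AddT : Remaining T′ ≐ (λ μ → Remaining T μ × ¬ A μ)
    Remaining-AddT μ = (λ (cl , T′μ) → Product.map₁ (cl ,_) (AddT-∉ T′μ))
                     , (λ ((cl , Tμ) , ¬Aμ) → cl , ¬-not ([ not-¬ Tμ , ¬Aμ ] ∘′ proj₁ (T′≡T∪A μ)))

    δ-Remaining-AddT : (σ : Subset n) → δ (Remaining T′) σ ≐ (λ μ → δ (Remaining T) σ μ × ¬ A μ)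
    δ-Remaining-AddT σ μ =
        (λ (R′μ , σ⊆μ , dμ) → let (Rμ , ¬Aμ) = proj₁ (Remaining-AddT μ) R′μ
                               in (Rμ , σ⊆μ , dμ) , ¬Aμ)
      , (λ ((Rμ , σ⊆μ , dμ) , ¬Aμ) → proj₂ (Remaining-AddT μ) (Rμ , ¬Aμ) , σ⊆μ , dμ)

    Remaining-AddT-∪ : (∀ {μ} → A μ → Remaining T μ) → (λ μ → Remaining T′ μ ⊎ A μ) ≐ Remaining T
    Remaining-AddT-∪ A⊆R μ = [ proj₁ ∘′ proj₁ (Remaining-AddT μ) , A⊆R ] , from
      where
      from : Remaining T μ → Remaining T′ μ ⊎ A μ
      from (cl , Tμ) with T′ μ in T′μ
      ... | true  = inj₂ ([ (λ Tμ≡true → contradiction Tμ≡true (not-¬ Tμ)) , id ]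
                            (proj₁ (T′≡T∪A μ) T′μ))
      ... | false = inj₁ (cl , refl)

  module _ {U U₁ : Subset n → Bool} {σ : Subset n} (U₁≡U-σ : Remove S F U σ U₁) where

    Remove-⊆ : ∀ {μ} → U₁ μ ≡ true → U μ ≡ true
    Remove-⊆ U₁μ = proj₁ (proj₁ (U₁≡U-σ _) U₁μ)

    Remove-keeps : ∀ {μ} → U μ ≡ true → μ ≢ σ → U₁ μ ≡ true
    Remove-keeps Uμ μ≢σ = proj₂ (U₁≡U-σ _) (Uμ , μ≢σ)

  module _ {D : Family n} {ρ ρ′ : Subset n → ℤ} {U U′ : Subset n → Bool}
           (decr : Decr S F D ρ U ρ′ U′) where

    Decr-on : ∀ {μ} → D μ → ρ′ μ ≡ ρ μ - + 1
    Decr-on {μ} = proj₁ (decr μ)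

    Decr-off : ∀ {μ} → ¬ D μ → ρ′ μ ≡ ρ μ
    Decr-off {μ} = proj₁ (proj₂ (decr μ))

    Decr-queued⁻ : ∀ {μ} → U′ μ ≡ true → U μ ≡ true ⊎ (D μ × ρ′ μ ≡ + 1)
    Decr-queued⁻ {μ} = proj₁ (proj₂ (proj₂ (decr μ)))

    Decr-queued⁺ : ∀ {μ} → U μ ≡ true ⊎ (D μ × ρ′ μ ≡ + 1) → U′ μ ≡ true
    Decr-queued⁺ {μ} = proj₂ (proj₂ (proj₂ (decr μ)))

    Decr-⊆S : (∀ {μ} → U μ ≡ true → μ ∈ S) → (∀ {μ} → D μ → μ ∈ S) → ∀ {μ} → U′ μ ≡ true → μ ∈ S
    Decr-⊆S U⊆S D⊆S = [ U⊆S , D⊆S ∘′ proj₁ ] ∘′ Decr-queued⁻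

  module Correctness (S-cosimplicial : IsCosimplicial S) (F-stack : IsStack S F)
                     (S-sorted : IsSortedEnum S F) where

    ∈S⇒nonempty : ∀ {σ} → σ ∈ S → Nonempty σ
    ∈S⇒nonempty = proj₁ (proj₂ S-cosimplicial) _

    ∈S⇒Closure : ∀ {σ} → σ ∈ S → Closure S σ
    ∈S⇒Closure σ∈S = ∈S⇒nonempty σ∈S , _ , σ∈S , ⊆-refl

    Closure-upward : ∀ {σ μ} → σ ∈ S → Closure S μ → σ ⊆ˢ μ → μ ∈ S
    Closure-upward σ∈S (_ , τ , τ∈S , μ⊆τ) σ⊆μ = proj₂ (proj₂ S-cosimplicial) _ _ τ σ∈S τ∈S σ⊆μ μ⊆τ

    ∂S⇒δ : ∀ {a σ} (K : Family n) → K a → ∂S S a σ → δ K σ a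
    ∂S⇒δ _ Ka ((_ , σ⊆a , da) , _) = Ka , σ⊆a , sym da

    δ⇒∂S : ∀ {a σ} (K : Family n) → σ ∈ S → δ K σ a → ∂S S a σ
    δ⇒∂S _ σ∈S (_ , σ⊆a , da) = (∈S⇒Closure σ∈S , σ⊆a , sym da) , σ∈S

    proper-coface-earlier : ∀ {i ν μ} → at S i ≡ just ν → μ ∈ S → ν ⊆ˢ μ → μ ≢ ν →
                            ∃[ j ] (j < i × at S j ≡ just μ)
    proper-coface-earlier {i} {ν} {μ} S[i]≡ν μ∈S ν⊆μ μ≢ν with ∈⇒at μ∈S
    ... | j , S[j]≡μ , _ with <-cmp (suc j) i
    ...   | tri< j<i _ _  = suc j , j<i , S[j]≡μ
    ...   | tri≈ _ refl _ = contradiction (just-injective (trans (sym S[j]≡μ) S[i]≡ν)) μ≢ν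
    ...   | tri> _ _ i<j  =
      contradiction (⊆∧≢⇒dim< (∈S⇒nonempty ν∈S) ν⊆μ (≢-sym μ≢ν)) (≤⇒≯ dimμ≤dimν)
      where
      ν∈S : ν ∈ S
      ν∈S = at-∈ S i S[i]≡ν
      sorted : F μ ≤ℤ F ν × (F ν ≡ F μ → dim μ ≤ dim ν)
      sorted = S-sorted i (suc j) ν μ i<j S[i]≡ν S[j]≡μ
      dimμ≤dimν : dim μ ≤ dim ν
      dimμ≤dimν = proj₂ sorted (ℤ.≤-antisym (F-stack ν μ ν∈S μ∈S ν⊆μ) (proj₁ sorted))

    Enumerated : ℕ → (Subset n → Bool) → Set
    Enumerated i T = ∀ {j σ} → j < i → at S j ≡ just σ → T σ ≡ true

    enumerated-coface : ∀ {i T ν μ} → Enumerated i T → at S i ≡ just ν →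
                        μ ∈ S → ν ⊆ˢ μ → T μ ≡ false → μ ≡ ν
    enumerated-coface {ν = ν} {μ} T⊇S[<i] S[i]≡ν μ∈S ν⊆μ Tμ = decidable-stable (μ ≟ˢ ν) λ μ≢ν →
      let (j , j<i , S[j]≡μ) = proper-coface-earlier S[i]≡ν μ∈S ν⊆μ μ≢ν
      in not-¬ Tμ (T⊇S[<i] j<i S[j]≡μ)

    UpwardClosed : (Subset n → Bool) → Set
    UpwardClosed T = ∀ {σ μ} → μ ∈ S → σ ⊆ˢ μ → T σ ≡ true → T μ ≡ true

    Counts : (Subset n → Bool) → (Subset n → ℤ) → Set
    Counts T ρ = ∀ {σ} → σ ∈ S → ∃[ k ] (Card S F (δ (Remaining T) σ) k × ρ σ ≡ + k)

    FlatFreeFacesQueued : (T U : Subset n → Bool) → (Subset n → ℤ) → Set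
    FlatFreeFacesQueued T U ρ = ∀ {σ τ} → σ ∈ S → T σ ≡ false → U σ ≡ false → ρ σ ≡ + 1 →
                                δ (Remaining T) σ τ → F τ ≢ F σ

    record Bookkeeping (T U : Subset n → Bool) (ρ : Subset n → ℤ) : Set where
      field
        T⊆S         : ∀ {μ} → T μ ≡ true → μ ∈ S
        T-upward    : UpwardClosed T
        U⊆S         : ∀ {μ} → U μ ≡ true → μ ∈ S
        ρ-counts    : Counts T ρ
        flat-queued : FlatFreeFacesQueued T U ρ

      Remaining-isComplex : IsComplex (Remaining T)
      Remaining-isComplex = (λ _ → proj₁ ∘′ proj₁) , closed
        where
        closed : ∀ σ τ → Remaining T τ → σ ⊆ˢ τ → Nonempty σ → Remaining T σ
        closed σ τ (clτ , Tτ) σ⊆τ σ≠∅ =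
            proj₂ Closure-isComplex σ τ clτ σ⊆τ σ≠∅
          , ¬-not (λ Tσ → not-¬ Tτ (T-upward (Closure-upward (T⊆S Tσ) clτ σ⊆τ) σ⊆τ Tσ))

      ρ≡1⇒sole-cofacet : ∀ {σ τ} → σ ∈ S → ρ σ ≡ + 1 → δ (Remaining T) σ τ →
                         SoleCofacet (Remaining T) σ τ
      ρ≡1⇒sole-cofacet σ∈S ρσ≡1 δτ with ρ-counts σ∈S
      ... | k , card , ρσ≡k with ℤ.+-injective (trans (sym ρσ≡k) ρσ≡1)
      ...   | refl = δτ , λ ν δν → Card-1⇒≡ card δν δτ

      sole-cofacet⇒ρ≡1 : ∀ {σ τ} → σ ∈ S → SoleCofacet (Remaining T) σ τ → ρ σ ≡ + 1
      sole-cofacet⇒ρ≡1 σ∈S (δτ , sole) with ρ-counts σ∈S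
      ... | k , card , ρσ≡k = trans ρσ≡k (cong +_ (Card-unique card (sole⇒Card-1 δτ sole)))

      free-pair : ∀ {σ τ} → σ ∈ S → ρ σ ≡ + 1 → δS S σ τ → T τ ≡ false → FreePair (Remaining T) σ τ
      free-pair {σ} σ∈S ρσ≡1 (clτ , σ⊆τ , dτ) Tτ = sole-cofacet⇒free Remaining-isComplex Rσ
        (ρ≡1⇒sole-cofacet σ∈S ρσ≡1 ((clτ , Tτ) , σ⊆τ , dτ))
        where
        Rσ : Remaining T σ
        Rσ = ∈S⇒Closure σ∈S , ¬-not (not-¬ Tτ ∘′ T-upward (Closure-upward σ∈S clτ σ⊆τ) σ⊆τ)

      no-flat-free-pair : ∀ {σ τ} → QueueEmpty U → σ ∈ S → F σ ≡ F τ → ¬ FreePair (Remaining T) σ τ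
      no-flat-free-pair {σ} {τ} U≡∅ σ∈S Fσ≡Fτ free@((_ , Tσ) , _) =
        flat-queued σ∈S Tσ (U≡∅ σ) (sole-cofacet⇒ρ≡1 σ∈S sole) (proj₁ sole) (sym Fσ≡Fτ)
        where
        sole : SoleCofacet (Remaining T) σ τ
        sole = free⇒sole-cofacet Remaining-isComplex free

    module _ {T T′ : Subset n → Bool} {A : Family n} (T′≡T∪A : AddT S F T A T′) where

      AddT-⊆S : (∀ {μ} → T μ ≡ true → μ ∈ S) → (∀ {μ} → A μ → μ ∈ S) → ∀ {μ} → T′ μ ≡ true → μ ∈ S
      AddT-⊆S T⊆S A⊆S T′μ = [ T⊆S , A⊆S ] (proj₁ (T′≡T∪A _) T′μ)

      AddT-upward : UpwardClosed T → (∀ {σ μ} → A σ → μ ∈ S → σ ⊆ˢ μ → T μ ≡ false → A μ) →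
                    UpwardClosed T′
      AddT-upward T-upward A-upward {σ} {μ} μ∈S σ⊆μ T′σ with T μ in Tμ
      ... | true  = AddT-⊇ T′≡T∪A Tμ
      ... | false = AddT-∋ T′≡T∪A (Aμ (proj₁ (T′≡T∪A σ) T′σ))
        where
        Aμ : T σ ≡ true ⊎ A σ → A μ
        Aμ (inj₁ Tσ) = contradiction (T-upward μ∈S σ⊆μ Tσ) (not-¬ Tμ)
        Aμ (inj₂ Aσ) = A-upward Aσ μ∈S σ⊆μ Tμ

    CofacetIn : (Subset n → Bool) → Family n → Family n
    CofacetIn T A σ = ∃[ a ] (A a × δ (Remaining T) σ a)

    module _ {T T′ U₁ U′ : Subset n → Bool} {A D : Family n} {ρ ρ′ : Subset n → ℤ}
             (T′≡T∪A : AddT S F T A T′) (decr : Decr S F D ρ U₁ ρ′ U′) where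

      -- All cofacets of σ have the same dimension and A has at most one simplex per
      -- dimension, so σ loses at most one cofacet.
      Counts-remove : Counts T ρ → Decidable A → (∀ {a b} → A a → A b → dim a ≡ dim b → a ≡ b) →
                      (∀ {σ} → σ ∈ S → (D σ → CofacetIn T A σ) × (CofacetIn T A σ → D σ)) →
                      Counts T′ ρ′
      Counts-remove counts A? A-dim D⇔ {σ} σ∈S with counts σ∈S
      ... | k , card@(L , _ , L≐δ , _) , ρσ≡k with any? A? L
      ...   | no A∩L≡∅ = k , Card-resp-≐ δ≐δ′ card , trans (Decr-off decr ¬Dσ) ρσ≡k
        where
        disjoint : ∀ {μ} → δ (Remaining T) σ μ → ¬ A μ
        disjoint δμ Aμ = A∩L≡∅ (lose (proj₂ (L≐δ _) δμ) Aμ)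
        ¬Dσ : ¬ D σ
        ¬Dσ Dσ = let (a , Aa , δa) = proj₁ (D⇔ σ∈S) Dσ in disjoint δa Aa
        δ≐δ′ : δ (Remaining T) σ ≐ δ (Remaining T′) σ
        δ≐δ′ μ = (λ δμ → proj₂ (δ-Remaining-AddT T′≡T∪A σ μ) (δμ , disjoint δμ))
               , proj₁ ∘′ proj₁ (δ-Remaining-AddT T′≡T∪A σ μ)
      ...   | yes A∩L with find A∩L
      ...     | a , a∈L , Aa with Card-remove card (proj₁ (L≐δ a) a∈L)
      ...       | k′ , refl , card′ =
        k′ , Card-resp-≐ δ-a≐δ′ card′ , trans (Decr-on decr Dσ) (cong (_- + 1) ρσ≡k)
        where
        δa : δ (Remaining T) σ a
        δa = proj₁ (L≐δ a) a∈L
        dim≡ : ∀ {μ} → δ (Remaining T) σ μ → dim μ ≡ suc (dim σ)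
        dim≡ = proj₂ ∘′ proj₂
        Dσ : D σ
        Dσ = proj₂ (D⇔ σ∈S) (a , Aa , δa)
        δ-a≐δ′ : (λ μ → δ (Remaining T) σ μ × μ ≢ a) ≐ δ (Remaining T′) σ
        δ-a≐δ′ μ =
            (λ (δμ , μ≢a) → proj₂ (δ-Remaining-AddT T′≡T∪A σ μ)
                              (δμ , λ Aμ → μ≢a (A-dim Aμ Aa (trans (dim≡ δμ) (sym (dim≡ δa))))))
          , (λ δ′μ → let (δμ , ¬Aμ) = proj₁ (δ-Remaining-AddT T′≡T∪A σ μ) δ′μ
                     in δμ , λ μ≡a → ¬Aμ (subst A (sym μ≡a) Aa))

      FlatFreeFacesQueued-remove : ∀ {U} → FlatFreeFacesQueued T U ρ →
                                   (∀ {μ} → ¬ A μ → U₁ μ ≡ false → U μ ≡ false) →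
                                   FlatFreeFacesQueued T′ U′ ρ′
      FlatFreeFacesQueued-remove flat-queued U₁⊇U-A {σ} σ∈S T′σ U′σ ρ′σ≡1 δ′τ =
        flat-queued σ∈S (proj₁ Tσ∧¬Aσ) (U₁⊇U-A (proj₂ Tσ∧¬Aσ) U₁σ) ρσ≡1
                    (proj₁ (proj₁ (δ-Remaining-AddT T′≡T∪A σ _) δ′τ))
        where
        Tσ∧¬Aσ : T σ ≡ false × ¬ A σ
        Tσ∧¬Aσ = AddT-∉ T′≡T∪A T′σ
        ¬Dσ : ¬ D σ
        ¬Dσ Dσ = not-¬ U′σ (Decr-queued⁺ decr (inj₂ (Dσ , ρ′σ≡1)))
        ρσ≡1 : ρ σ ≡ + 1
        ρσ≡1 = trans (sym (Decr-off decr ¬Dσ)) ρ′σ≡1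
        U₁σ : U₁ σ ≡ false
        U₁σ = ¬-not (not-¬ U′σ ∘′ Decr-queued⁺ decr ∘′ inj₁)

    module _ {T U U₁ : Subset n → Bool} {ρ : Subset n → ℤ} {σ₀ : Subset n}
             (bk : Bookkeeping T U ρ) (U₁≡U-σ₀ : Remove S F U σ₀ U₁) where

      open Bookkeeping bk

      Bookkeeping-dequeue : (T σ₀ ≡ false → ρ σ₀ ≡ + 1 → ∀ {τ} → δ (Remaining T) σ₀ τ → F τ ≢ F σ₀) →
                            Bookkeeping T U₁ ρ
      Bookkeeping-dequeue σ₀-steep = record
        { T⊆S = T⊆S ; T-upward = T-upward ; U⊆S = U⊆S ∘′ Remove-⊆ U₁≡U-σ₀
        ; ρ-counts = ρ-counts ; flat-queued = flat-queued₁ }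
        where
        flat-queued₁ : FlatFreeFacesQueued T U₁ ρ
        flat-queued₁ {σ} σ∈S Tσ U₁σ ρσ≡1 δτ with σ ≟ˢ σ₀
        ... | yes refl = σ₀-steep Tσ ρσ≡1 δτ
        ... | no σ≢σ₀ = flat-queued σ∈S Tσ Uσ ρσ≡1 δτ
          where
          Uσ : U σ ≡ false
          Uσ = ¬-not (λ Uσ → not-¬ U₁σ (Remove-keeps U₁≡U-σ₀ Uσ σ≢σ₀))

      Bookkeeping-dequeue-steep : ∀ {τ₀} → U σ₀ ≡ true → ρ σ₀ ≡ + 1 → δ (Remaining T) σ₀ τ₀ →
                                  F τ₀ ≢ F σ₀ → Bookkeeping T U₁ ρ
      Bookkeeping-dequeue-steep Uσ₀ ρσ₀≡1 δτ₀ Fτ₀≢Fσ₀ = Bookkeeping-dequeue λ _ _ δτ →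
        subst (λ τ → F τ ≢ F σ₀) (sym (proj₂ (ρ≡1⇒sole-cofacet (U⊆S Uσ₀) ρσ₀≡1 δτ₀) _ δτ)) Fτ₀≢Fσ₀

    Bookkeeping-pair : ∀ {T T′ U U₁ U′ ρ ρ′ σ₀ τ₀} → Bookkeeping T U ρ → Remove S F U σ₀ U₁ →
                       σ₀ ∈ S → FreePair (Remaining T) σ₀ τ₀ →
                       AddT S F T (λ μ → μ ≡ σ₀ ⊎ μ ≡ τ₀) T′ →
                       Decr S F (λ μ → ∂S S σ₀ μ ⊎ ∂S S τ₀ μ) ρ U₁ ρ′ U′ → Bookkeeping T′ U′ ρ′
    Bookkeeping-pair {T} {U = U} {U₁} {σ₀ = σ₀} {τ₀}
                     bk U₁≡U-σ₀ σ₀∈S free@(Rσ₀ , Rτ₀ , σ₀⊆τ₀ , _ , only) T′≡T∪A decr =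
      record
        { T⊆S         = AddT-⊆S T′≡T∪A T⊆S [ (λ { refl → σ₀∈S }) , (λ { refl → τ₀∈S }) ]
        ; T-upward    = AddT-upward T′≡T∪A T-upward A-upward
        ; U⊆S         = Decr-⊆S decr (U⊆S ∘′ Remove-⊆ U₁≡U-σ₀) [ proj₂ , proj₂ ]
        ; ρ-counts    = Counts-remove T′≡T∪A decr ρ-counts A? A-dim D⇔
        ; flat-queued = FlatFreeFacesQueued-remove T′≡T∪A decr flat-queued U₁⊇U-A
        }
      where
      open Bookkeeping bk
      A : Family n
      A μ = μ ≡ σ₀ ⊎ μ ≡ τ₀
      τ₀∈S : τ₀ ∈ S
      τ₀∈S = Closure-upward σ₀∈S (proj₁ Rτ₀) σ₀⊆τ₀
      dτ₀ : dim τ₀ ≡ suc (dim σ₀)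
      dτ₀ = proj₂ (proj₂ (proj₁ (free⇒sole-cofacet Remaining-isComplex free)))
      A-upward : ∀ {σ μ} → A σ → μ ∈ S → σ ⊆ˢ μ → T μ ≡ false → A μ
      A-upward {σ} {μ} Aσ μ∈S σ⊆μ Tμ = only μ (∈S⇒Closure μ∈S , Tμ) (σ₀⊆μ Aσ)
        where
        σ₀⊆μ : A σ → σ₀ ⊆ˢ μ
        σ₀⊆μ (inj₁ refl) = σ⊆μ
        σ₀⊆μ (inj₂ refl) = ⊆-trans σ₀⊆τ₀ σ⊆μ
      A? : Decidable A
      A? μ = μ ≟ˢ σ₀ ⊎-dec μ ≟ˢ τ₀
      A-dim : ∀ {a b} → A a → A b → dim a ≡ dim b → a ≡ b
      A-dim (inj₁ refl) (inj₁ refl) _ = refl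
      A-dim (inj₂ refl) (inj₂ refl) _ = refl
      A-dim (inj₁ refl) (inj₂ refl) d = contradiction (trans (sym dτ₀) (sym d)) 1+n≢n
      A-dim (inj₂ refl) (inj₁ refl) d = contradiction (trans (sym dτ₀) d) 1+n≢n
      D⇔ : ∀ {σ} → σ ∈ S → (∂S S σ₀ σ ⊎ ∂S S τ₀ σ → CofacetIn T A σ)
                          × (CofacetIn T A σ → ∂S S σ₀ σ ⊎ ∂S S τ₀ σ)
      D⇔ σ∈S = [ (λ ∂σ₀ → σ₀ , inj₁ refl , ∂S⇒δ (Remaining T) Rσ₀ ∂σ₀)
               , (λ ∂τ₀ → τ₀ , inj₂ refl , ∂S⇒δ (Remaining T) Rτ₀ ∂τ₀) ]
             , λ { (_ , inj₁ refl , δa) → inj₁ (δ⇒∂S (Remaining T) σ∈S δa)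
                 ; (_ , inj₂ refl , δa) → inj₂ (δ⇒∂S (Remaining T) σ∈S δa) }
      U₁⊇U-A : ∀ {μ} → ¬ A μ → U₁ μ ≡ false → U μ ≡ false
      U₁⊇U-A ¬Aμ U₁μ = ¬-not (λ Uμ → not-¬ U₁μ (Remove-keeps U₁≡U-σ₀ Uμ (¬Aμ ∘′ inj₁)))

    Bookkeeping-crit : ∀ {i T T′ U U′ ρ ρ′ ν} → Bookkeeping T U ρ → Enumerated i T →
                       at S i ≡ just ν → T ν ≡ false → AddT S F T (λ μ → μ ≡ ν) T′ →
                       Decr S F (∂S S ν) ρ U ρ′ U′ → Bookkeeping T′ U′ ρ′
    Bookkeeping-crit {i} {T} {ν = ν} bk T⊇S[<i] S[i]≡ν Tν T′≡T∪ν decr = record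
      { T⊆S         = AddT-⊆S T′≡T∪ν T⊆S (λ { refl → ν∈S })
      ; T-upward    = AddT-upward T′≡T∪ν T-upward (λ { refl → enumerated-coface T⊇S[<i] S[i]≡ν })
      ; U⊆S         = Decr-⊆S decr U⊆S proj₂
      ; ρ-counts    = Counts-remove T′≡T∪ν decr ρ-counts (_≟ˢ ν) (λ { refl refl _ → refl }) D⇔
      ; flat-queued = FlatFreeFacesQueued-remove T′≡T∪ν decr flat-queued (λ _ → id)
      }
      where
      open Bookkeeping bk
      ν∈S : ν ∈ S
      ν∈S = at-∈ S i S[i]≡ν
      D⇔ : ∀ {σ} → σ ∈ S → (∂S S ν σ → CofacetIn T (_≡ ν) σ) × (CofacetIn T (_≡ ν) σ → ∂S S ν σ)
      D⇔ σ∈S = (λ ∂ν → ν , refl , ∂S⇒δ (Remaining T) (∈S⇒Closure ν∈S , Tν) ∂ν)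
             , λ { (_ , refl , δν) → δ⇒∂S (Remaining T) σ∈S δν }

    Sound : (Subset n → Bool) → List (Item n) → Set
    Sound T W = MorseSteps (Remaining T) W (Closure S)
              × RegularPairsFlat S F W
              × MinFrom S F (Remaining T) W

    Sound-pair : ∀ {T T′ U ρ σ₀ τ₀ W} → Bookkeeping T U ρ → FreePair (Remaining T) σ₀ τ₀ →
                 F σ₀ ≡ F τ₀ → AddT S F T (λ μ → μ ≡ σ₀ ⊎ μ ≡ τ₀) T′ →
                 Sound T W → Sound T′ (reg σ₀ τ₀ ∷ W)
    Sound-pair {T} {T′} {σ₀ = σ₀} {τ₀} {W}
               bk free@(Rσ₀ , Rτ₀ , _) Fσ₀≡Fτ₀ T′≡T∪A (morse , flat , minimal) =
        ( ( not-¬ σ₀∈T′ ∘′ proj₂ , not-¬ τ₀∈T′ ∘′ proj₂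
          , IsComplex-resp-≐ R≐R′∪A (Bookkeeping.Remaining-isComplex bk)
          , FreePair-resp-≐ R≐R′∪A free )
        , MorseSteps-resp-≐ W R≐R′∪A morse )
      , (Fσ₀≡Fτ₀ , flat)
      , MinFrom-resp-≐ S F W R≐R′∪A minimal
      where
      σ₀∈T′ : T′ σ₀ ≡ true
      σ₀∈T′ = AddT-∋ T′≡T∪A (inj₁ refl)
      τ₀∈T′ : T′ τ₀ ≡ true
      τ₀∈T′ = AddT-∋ T′≡T∪A (inj₂ refl)
      R≐R′∪A : Remaining T ≐ (Remaining T′ ∪₂ σ₀ , τ₀)
      R≐R′∪A = ≐-sym (Remaining-AddT-∪ T′≡T∪A λ { (inj₁ refl) → Rσ₀ ; (inj₂ refl) → Rτ₀ })

    Sound-crit : ∀ {T T′ U ρ ν W} → Bookkeeping T U ρ → QueueEmpty U → Maximal (Remaining T) ν →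
                 AddT S F T (λ μ → μ ≡ ν) T′ → Sound T W → Sound T′ (crit ν ∷ W)
    Sound-crit {T} {T′} {ν = ν} {W} bk U≡∅ maximal@(Rν , _) T′≡T∪ν (morse , flat , minimal) =
        ( ( not-¬ (AddT-∋ T′≡T∪ν refl) ∘′ proj₂
          , IsComplex-resp-≐ R≐R′∪ν (Bookkeeping.Remaining-isComplex bk)
          , Maximal-resp-≐ R≐R′∪ν maximal )
        , MorseSteps-resp-≐ W R≐R′∪ν morse )
      , flat
      , ( (λ σ τ σ∈S _ Fσ≡Fτ → Bookkeeping.no-flat-free-pair bk U≡∅ σ∈S Fσ≡Fτ
                                ∘′ FreePair-resp-≐ (≐-sym R≐R′∪ν))
        , MinFrom-resp-≐ S F W R≐R′∪ν minimal )
      where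
      R≐R′∪ν : Remaining T ≐ (Remaining T′ ∪₁ ν)
      R≐R′∪ν = ≐-sym (Remaining-AddT-∪ T′≡T∪ν λ { refl → Rν })

    PhaseOK : Phase S F → ℕ → (T U : Subset n → Bool) → Set
    PhaseOK outer _ _ _ = ⊤
    PhaseOK loopA _ _ _ = ⊤
    PhaseOK loopB _ _ U = QueueEmpty U
    PhaseOK stepC i T U = QueueEmpty U × (length S < i ⊎ ∃[ σ ] (at S i ≡ just σ × T σ ≡ false))
    PhaseOK done  i _ _ = length S < i

    Invariant : State S F → Set
    Invariant ⟨ pc , i , T , U , ρ , W ⟩ =
      Bookkeeping T U ρ × Enumerated i T × PhaseOK pc i T U × Sound T W

    Enumerated-AddT : ∀ {i} {T T′ : Subset n → Bool} {A : Family n} →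
                      AddT S F T A T′ → Enumerated i T → Enumerated i T′
    Enumerated-AddT T′≡T∪A T⊇S[<i] j<i S[j]≡σ = AddT-⊇ T′≡T∪A (T⊇S[<i] j<i S[j]≡σ)

    Enumerated-suc : ∀ {i T σ} → Enumerated i T → at S i ≡ just σ → T σ ≡ true → Enumerated (suc i) T
    Enumerated-suc {T = T} T⊇S[<i] S[i]≡σ Tσ j<1+i S[j]≡μ with m<1+n⇒m<n∨m≡n j<1+i
    ... | inj₁ j<i  = T⊇S[<i] j<i S[j]≡μ
    ... | inj₂ refl = subst (λ μ → T μ ≡ true) (just-injective (trans (sym S[i]≡σ) S[j]≡μ)) Tσ

    Enumerated-maximal : ∀ {i T ν} → Enumerated i T → at S i ≡ just ν → T ν ≡ false →
                         Maximal (Remaining T) ν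
    Enumerated-maximal {i} {ν = ν} T⊇S[<i] S[i]≡ν Tν =
        (∈S⇒Closure ν∈S , Tν)
      , λ μ (clμ , Tμ) ν⊆μ → enumerated-coface T⊇S[<i] S[i]≡ν (Closure-upward ν∈S clμ ν⊆μ) ν⊆μ Tμ
      where
      ν∈S : ν ∈ S
      ν∈S = at-∈ S i S[i]≡ν

    next-unprocessed : ∀ {i} {T : Subset n → Bool} {τ} →
                       (length S < i ⊎ ∃[ σ ] (at S i ≡ just σ × T σ ≡ false)) →
                       at S i ≡ just τ → T τ ≡ false
    next-unprocessed {i} (inj₁ ∣S∣<i) S[i]≡τ =
      contradiction (trans (sym S[i]≡τ) (at-beyond S i ∣S∣<i)) λ ()
    next-unprocessed {T = T} (inj₂ (σ , S[i]≡σ , Tσ)) S[i]≡τ =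
      subst (λ μ → T μ ≡ false) (just-injective (trans (sym S[i]≡σ) S[i]≡τ)) Tσ

    step-invariant : ∀ {s s′} → Step S F s s′ → Invariant s → Invariant s′
    step-invariant (outer-go _)       (bk , en , _ , sound) = bk , en , tt , sound
    step-invariant (outer-stop ∣S∣<i) (bk , en , _ , sound) = bk , en , ∣S∣<i , sound
    step-invariant (a-exit U≡∅)       (bk , en , _ , sound) = bk , en , U≡∅ , sound
    step-invariant (a-skip σ _ U₁≡U-σ ρσ≢1) (bk , en , _ , sound) =
      Bookkeeping-dequeue bk U₁≡U-σ (λ _ ρσ≡1 → contradiction ρσ≡1 ρσ≢1) , en , tt , sound
    step-invariant (a-noeq σ τ Uσ U₁≡U-σ ρσ≡1 (clτ , σ⊆τ , dτ) Tτ Fτ≢Fσ) (bk , en , _ , sound) =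
      Bookkeeping-dequeue-steep bk U₁≡U-σ Uσ ρσ≡1 ((clτ , Tτ) , σ⊆τ , dτ) Fτ≢Fσ , en , tt , sound
    step-invariant (a-pair {T = T} σ τ Uσ U₁≡U-σ ρσ≡1 δτ Tτ Fτ≡Fσ T′≡T∪A decr) (bk , en , _ , sound) =
        Bookkeeping-pair bk U₁≡U-σ σ∈S free T′≡T∪A decr
      , Enumerated-AddT T′≡T∪A en , tt
      , Sound-pair bk free (sym Fτ≡Fσ) T′≡T∪A sound
      where
      σ∈S : σ ∈ S
      σ∈S = Bookkeeping.U⊆S bk Uσ
      free : FreePair (Remaining T) σ τ
      free = Bookkeeping.free-pair bk σ∈S ρσ≡1 δτ Tτ
    step-invariant (b-inc σ S[i]≡σ Tσ) (bk , en , U≡∅ , sound) =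
      bk , Enumerated-suc en S[i]≡σ Tσ , U≡∅ , sound
    step-invariant (b-exit next) (bk , en , U≡∅ , sound) = bk , en , (U≡∅ , next) , sound
    step-invariant (c-go {T = T} τ S[i]≡τ T′≡T∪τ decr) (bk , en , (U≡∅ , next) , sound) =
        Bookkeeping-crit bk en S[i]≡τ Tτ T′≡T∪τ decr
      , Enumerated-AddT T′≡T∪τ en , tt
      , Sound-crit bk U≡∅ (Enumerated-maximal en S[i]≡τ Tτ) T′≡T∪τ sound
      where
      Tτ : T τ ≡ false
      Tτ = next-unprocessed {T = T} next S[i]≡τ
    step-invariant (c-skip _) (bk , en , _ , sound) = bk , en , tt , sound

    initial-invariant : ∀ {s} → Initial S F s → Invariant s
    initial-invariant {⟨ _ , _ , T , U , ρ , _ ⟩} (refl , refl , T≡∅ , refl , counts , U-spec) =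
      bk , S[<1]⊆T , tt , (R≐Closure , tt , tt)
      where
      T-empty : ∀ {μ} → ¬ T μ ≡ true
      T-empty = not-¬ (T≡∅ _)
      R≐Closure : Remaining T ≐ Closure S
      R≐Closure μ = proj₁ , λ clμ → clμ , T≡∅ μ
      δS≐δR : ∀ {σ} → δS S σ ≐ δ (Remaining T) σ
      δS≐δR μ = δ-mono {K = Closure S} (λ {ν} clν → clν , T≡∅ ν) , δ-mono {K = Remaining T} proj₁
      bk : Bookkeeping T U ρ
      bk = record
        { T⊆S         = λ Tμ → contradiction Tμ T-empty
        ; T-upward    = λ _ _ Tσ → contradiction Tσ T-empty
        ; U⊆S         = λ Uμ → proj₁ (proj₁ (U-spec _) Uμ)
        ; ρ-counts    = λ {σ} σ∈S → let (k , card , ρσ≡k) = counts σ σ∈S in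
                          k , Card-resp-≐ δS≐δR card , ρσ≡k
        ; flat-queued = λ {σ} σ∈S _ Uσ ρσ≡1 _ →
                          contradiction (proj₂ (U-spec σ) (σ∈S , ρσ≡1)) (not-¬ Uσ)
        }
      S[<1]⊆T : Enumerated 1 T
      S[<1]⊆T (s≤s z≤n) S[0]≡σ = contradiction (trans (sym S[0]≡σ) (at-0 S)) λ ()

    invariant-preserved : ∀ {s s′} → Star (Step S F) s s′ → Invariant s → Invariant s′
    invariant-preserved ε              inv = inv
    invariant-preserved (step ◅ steps) inv = invariant-preserved steps (step-invariant step inv)

    Remaining≐Under : ∀ {i T U ρ} → Bookkeeping T U ρ → Enumerated i T → length S < i →
                      Remaining T ≐ Under S
    Remaining≐Under {T = T} bk T⊇S[<i] ∣S∣<i μ =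
        (λ (clμ , Tμ) → clμ , λ μ∈S → not-¬ Tμ (S⊆T μ∈S))
      , (λ (clμ , μ∉S) → clμ , ¬-not (μ∉S ∘′ Bookkeeping.T⊆S bk))
      where
      S⊆T : ∀ {σ} → σ ∈ S → T σ ≡ true
      S⊆T σ∈S = let (j , S[j]≡σ , 1+j≤∣S∣) = ∈⇒at σ∈S in T⊇S[<i] (≤-<-trans 1+j≤∣S∣ ∣S∣<i) S[j]≡σ

    minimal-output : (w : List (Item n)) → MinOutput S F w → IsMinimalFSequence S F w
    minimal-output w (_ , ⟨ _ , _ , T , _ , _ , _ ⟩ , init , run , refl , refl)
      with invariant-preserved run (initial-invariant init)
    ... | bk , en , ∣S∣<i , morse , flat , minimal =
        ( ( IsComplex-resp-≐ R≐Under (Bookkeeping.Remaining-isComplex bk)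
          , MorseSteps-resp-≐ w R≐Under morse )
        , flat )
      , MinFrom-resp-≐ S F w R≐Under minimal
      where
      R≐Under : Remaining T ≐ Under S
      R≐Under = Remaining≐Under bk en ∣S∣<i

proposition9 : {n : ℕ} (S : List (Subset n)) (F : Subset n → ℤ) →
    IsCosimplicial S → IsStack S F → IsSortedEnum S F →
    (w : List (Item n)) → MinOutput S F w → IsMinimalFSequence S F w
proposition9 S F S-cosimplicial F-stack S-sorted =
  MinProcedure.Correctness.minimal-output S F S-cosimplicial F-stack S-sorted
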